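{- Every maximalized proof in $\mathcal{G}$ of degree greater than $0$ of a sequent can be reduced to a proof of the same sequent of lower degree.
   Context: Formulae are built from propositional variables and $\bot$ with the binary connectives $\wedge,\vee,\rightarrow$. Sequents have the form $\Gamma \vdash C$, $\Gamma$ a finite (possibly empty) sequence of formulae, $C$ a formula. The system $\mathcal{G}$ has axioms $A \vdash A$ and $\bot \vdash A$ and rules: (C) from $\Delta, A, B, \Gamma \vdash C$ infer $\Delta, B, A, \Gamma \vdash C$; (W) from $\Theta, A, A, \Gamma \vdash C$ infer $\Theta, A, \Gamma \vdash C$; (K) from $\Theta, \Gamma \vdash C$ infer $\Theta, A, \Gamma \vdash C$; (cut) from $\Delta \vdash A$ and $\Theta, A, \Gamma \vdash C$ infer $\Theta, \Delta, \Gamma \vdash C$ ($A$ is the cut formula); ($\wedge$L) from $\Theta, A, \Gamma \vdash C$ (resp. $\Theta, B, \Gamma \vdash C$) infer $\Theta, A\wedge B, \Gamma \vdash C$; ($\wedge$R) from $\Gamma \vdash A$ and $\Gamma \vdash B$ infer $\Gamma \vdash A \wedge B$; ($\vee$L) from $\Theta, A, \Gamma \vdash C$ and $\Theta, B, \Gamma \vdash C$ infer $\Theta, A \vee B, \Gamma \vdash C$; ($\vee$R) from $\Gamma \vdash A$ (resp. $\Gamma \vdash B$) infer $\Gamma \vdash A \vee B$; ($\rightarrow$L) from $\Delta \vdash A$ and $\Theta, B, \Gamma \vdash C$ infer $\Theta, \Delta, A \rightarrow B, \Gamma \vdash C$; ($\rightarrow$R) from $A, \Gamma \vdash B$ infer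 $\Gamma \vdash A \rightarrow B$. The degree of a cut is the number of binary connectives in its cut formula; the degree of a proof is the maximal degree of its cuts (0 if none). A cut has rank 2 iff the occurrence of the cut formula in each premise is newly introduced by the last inference of the subproof ending in that premise (in the left premise: the succedent of an axiom or the principal formula of ($\wedge$R), ($\vee$R), ($\rightarrow$R); in the right premise: a formula of an axiom, the formula added by (K), or the principal formula of ($\wedge$L), ($\vee$L), ($\rightarrow$L)). A cut is maximal iff it has rank 2 and neither of its premises is an axiom. A proof is maximalized iff all cuts in it are maximal. -}

module Defs where

open import Data.Nat using (ℕ; zero; suc; _+_; _⊔_; _<_)
open import Data.List using (List; []; _∷_; _++_; [_]; length)
open import Data.Product using (_×_; Σ)
open import Data.Unit using (⊤; tt)
open import Data.Empty using (⊥)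
open import Relation.Binary.PropositionalEquality using (_≡_)

infixr 6 _∧_
infixr 5 _∨_
infixr 4 _⇒_

data Formula : Set where
  var : ℕ → Formula
  bot : Formula
  _∧_ _∨_ _⇒_ : Formula → Formula → Formula

size : Formula → ℕ
size (var _) = 0
size bot = 0
size (A ∧ B) = suc (size A + size B)
size (A ∨ B) = suc (size A + size B)
size (A ⇒ B) = suc (size A + size B)

Ctx : Set
Ctx = List Formula

infix 2 _⊢_

data _⊢_ : Ctx → Formula → Set where
  ax    : (A : Formula) → [ A ] ⊢ A
  botAx : (A : Formula) → [ bot ] ⊢ A
  exch  : (Δ Γ : Ctx) (A B : Formula) {C : Formula} →
          Δ ++ A ∷ B ∷ Γ ⊢ C → Δ ++ B ∷ A ∷ Γ ⊢ C
  contr : (Θ Γ : Ctx) (A : Formula) {C : Formula} →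
          Θ ++ A ∷ A ∷ Γ ⊢ C → Θ ++ A ∷ Γ ⊢ C
  weak  : (Θ Γ : Ctx) (A : Formula) {C : Formula} →
          Θ ++ Γ ⊢ C → Θ ++ A ∷ Γ ⊢ C
  cut   : (Δ Θ Γ : Ctx) (A : Formula) {C : Formula} →
          Δ ⊢ A → Θ ++ A ∷ Γ ⊢ C → Θ ++ Δ ++ Γ ⊢ C
  ∧L₁   : (Θ Γ : Ctx) (A B : Formula) {C : Formula} →
          Θ ++ A ∷ Γ ⊢ C → Θ ++ (A ∧ B) ∷ Γ ⊢ C
  ∧L₂   : (Θ Γ : Ctx) (A B : Formula) {C : Formula} →
          Θ ++ B ∷ Γ ⊢ C → Θ ++ (A ∧ B) ∷ Γ ⊢ C
  ∧R    : (Γ : Ctx) (A B : Formula) →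
          Γ ⊢ A → Γ ⊢ B → Γ ⊢ A ∧ B
  ∨L    : (Θ Γ : Ctx) (A B : Formula) {C : Formula} →
          Θ ++ A ∷ Γ ⊢ C → Θ ++ B ∷ Γ ⊢ C → Θ ++ (A ∨ B) ∷ Γ ⊢ C
  ∨R₁   : (Γ : Ctx) (A B : Formula) → Γ ⊢ A → Γ ⊢ A ∨ B
  ∨R₂   : (Γ : Ctx) (A B : Formula) → Γ ⊢ B → Γ ⊢ A ∨ B
  ⇒L    : (Δ Θ Γ : Ctx) (A B : Formula) {C : Formula} →
          Δ ⊢ A → Θ ++ B ∷ Γ ⊢ C → Θ ++ Δ ++ (A ⇒ B) ∷ Γ ⊢ C
  ⇒R    : (Γ : Ctx) (A B : Formula) → A ∷ Γ ⊢ B → Γ ⊢ A ⇒ B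

degree : ∀ {Γ C} → Γ ⊢ C → ℕ
degree (ax _) = 0
degree (botAx _) = 0
degree (exch _ _ _ _ p) = degree p
degree (contr _ _ _ p) = degree p
degree (weak _ _ _ p) = degree p
degree (cut _ _ _ A p q) = size A ⊔ (degree p ⊔ degree q)
degree (∧L₁ _ _ _ _ p) = degree p
degree (∧L₂ _ _ _ _ p) = degree p
degree (∧R _ _ _ p q) = degree p ⊔ degree q
degree (∨L _ _ _ _ p q) = degree p ⊔ degree q
degree (∨R₁ _ _ _ p) = degree p
degree (∨R₂ _ _ _ p) = degree p
degree (⇒L _ _ _ _ _ p q) = degree p ⊔ degree q
degree (⇒R _ _ _ p) = degree p

IntroR : ∀ {Γ C} → Γ ⊢ C → Set
IntroR (ax _) = ⊤
IntroR (botAx _) = ⊤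
IntroR (∧R _ _ _ _ _) = ⊤
IntroR (∨R₁ _ _ _ _) = ⊤
IntroR (∨R₂ _ _ _ _) = ⊤
IntroR (⇒R _ _ _ _) = ⊤
IntroR _ = ⊥

IntroL : ∀ {Γ C} → Γ ⊢ C → ℕ → Set
IntroL (ax _) n = n ≡ 0
IntroL (botAx _) n = n ≡ 0
IntroL (weak Θ _ _ _) n = n ≡ length Θ
IntroL (∧L₁ Θ _ _ _ _) n = n ≡ length Θ
IntroL (∧L₂ Θ _ _ _ _) n = n ≡ length Θ
IntroL (∨L Θ _ _ _ _ _) n = n ≡ length Θ
IntroL (⇒L Δ Θ _ _ _ _ _) n = n ≡ length Θ + length Δ
IntroL _ _ = ⊥

IsAxiom : ∀ {Γ C} → Γ ⊢ C → Set
IsAxiom (ax _) = ⊤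
IsAxiom (botAx _) = ⊤
IsAxiom _ = ⊥

NotAxiom : ∀ {Γ C} → Γ ⊢ C → Set
NotAxiom p = IsAxiom p → ⊥

Rank2 : ∀ {Δ A Γ' C} (Θ : Ctx) → Δ ⊢ A → Γ' ⊢ C → Set
Rank2 Θ p q = IntroR p × IntroL q (length Θ)

MaximalCut : ∀ {Δ A Γ' C} (Θ : Ctx) → Δ ⊢ A → Γ' ⊢ C → Set
MaximalCut Θ p q = Rank2 Θ p q × (NotAxiom p × NotAxiom q)

Maximalized : ∀ {Γ C} → Γ ⊢ C → Set
Maximalized (ax _) = ⊤
Maximalized (botAx _) = ⊤
Maximalized (exch _ _ _ _ p) = Maximalized p
Maximalized (contr _ _ _ p) = Maximalized p
Maximalized (weak _ _ _ p) = Maximalized p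
Maximalized (cut _ Θ _ _ p q) = MaximalCut Θ p q × (Maximalized p × Maximalized q)
Maximalized (∧L₁ _ _ _ _ p) = Maximalized p
Maximalized (∧L₂ _ _ _ _ p) = Maximalized p
Maximalized (∧R _ _ _ p q) = Maximalized p × Maximalized q
Maximalized (∨L _ _ _ _ p q) = Maximalized p × Maximalized q
Maximalized (∨R₁ _ _ _ p) = Maximalized p
Maximalized (∨R₂ _ _ _ p) = Maximalized p
Maximalized (⇒L _ _ _ _ _ p q) = Maximalized p × Maximalized q
Maximalized (⇒R _ _ _ p) = Maximalized p

-- Every cut of a maximalized proof either has a right premise that weakens the cut
-- formula in, or is principal on both sides. In the first case the cut is dropped and its
-- conclusion is obtained by weakenings; in the second, the principal reduction replaces it
-- by cuts on immediate subformulas of the cut formula, placed on the (recursively reduced)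
-- immediate subproofs of its premises. Every cut formula of the result is thus strictly
-- smaller than the degree d of the original proof, so the result has degree < d; the
-- axioms, of degree 0, need 0 < d.
module Submission where

open import Defs
open import Data.Nat using (ℕ; suc; s≤s; _+_; _⊔_; _≤_; _<_)
open import Data.Nat.Properties
  using (≤-refl; ≤-trans; suc-injective; m≤n+m; m+n≤o⇒m≤o; ⊔-lub; m⊔n≤o⇒m≤o; m⊔n≤o⇒n≤o)
open import Data.List using (List; []; _∷_; _++_; length)
open import Data.List.Properties using (∷-injective; length-++; ++-assoc)
open import Data.Product using (Σ; Σ-syntax; _×_; _,_; map; zip; uncurry)
open import Data.Unit using (tt)
open import Data.Empty using (⊥-elim)
open import Function using (id)
open import Relation.Binary.PropositionalEquality using (_≡_; refl; sym; trans; cong; subst)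

1+m+n≤o⇒m<o : ∀ {m n o} → suc (m + n) ≤ o → m < o
1+m+n≤o⇒m<o {m} = m+n≤o⇒m≤o (suc m)

1+m+n≤o⇒n<o : ∀ {m n o} → suc (m + n) ≤ o → n < o
1+m+n≤o⇒n<o {m} {n} = ≤-trans (s≤s (m≤n+m n m))

++-injective : ∀ {a} {A : Set a} (xs ys : List A) {zs ws : List A} →
               length xs ≡ length ys → xs ++ zs ≡ ys ++ ws → xs ≡ ys × zs ≡ ws
++-injective []       []       _   eq = refl , eq
++-injective (x ∷ xs) (y ∷ ys) len eq with ∷-injective eq
... | refl , eq′ with ++-injective xs ys (suc-injective len) eq′
... | refl , refl = refl , refl

infix 2 _⊢[<_]_

_⊢[<_]_ : Ctx → ℕ → Formula → Set
Γ ⊢[< d ] C = Σ[ p ∈ Γ ⊢ C ] degree p < d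

weaken< : ∀ {Γ C d} (Θ Δ : Ctx) → Θ ++ Γ ⊢[< d ] C → Θ ++ Δ ++ Γ ⊢[< d ] C
weaken< Θ []      p = p
weaken< Θ (A ∷ Δ) p = map (weak Θ _ A) id (weaken< Θ Δ p)

cut< : ∀ {Δ Γ A C d} (Θ : Ctx) → size A < d →
       Δ ⊢[< d ] A → Θ ++ A ∷ Γ ⊢[< d ] C → Θ ++ Δ ++ Γ ⊢[< d ] C
cut< Θ A<d (p , p<d) (q , q<d) = cut _ Θ _ _ p q , ⊔-lub A<d (⊔-lub p<d q<d)

⇒-cut< : ∀ {Δ Δ′ Θ Γ A B C d} → size (A ⇒ B) ≤ d →
         A ∷ Δ ⊢[< d ] B → Δ′ ⊢[< d ] A → Θ ++ B ∷ Γ ⊢[< d ] C →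
         (Θ ++ Δ′) ++ Δ ++ Γ ⊢[< d ] C
⇒-cut< {Δ} {Δ′} {Θ} {Γ} {C = C} A⇒B≤d p r q =
  subst (_⊢[< _ ] C) reassociate
    (cut< Θ (1+m+n≤o⇒n<o A⇒B≤d) (cut< [] (1+m+n≤o⇒m<o A⇒B≤d) r p) q)
  where
  reassociate : Θ ++ (Δ′ ++ Δ) ++ Γ ≡ (Θ ++ Δ′) ++ Δ ++ Γ
  reassociate = trans (cong (Θ ++_) (++-assoc Δ′ Δ Γ)) (sym (++-assoc Θ Δ′ (Δ ++ Γ)))

-- Both views are indexed by the proof they analyse, so recursion on the subproofs they
-- expose remains structural.
data RightIntro : ∀ {Δ A} → Δ ⊢ A → Set where
  ∧R  : ∀ {Δ A B} (p₁ : Δ ⊢ A) (p₂ : Δ ⊢ B) → RightIntro (∧R Δ A B p₁ p₂)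
  ∨R₁ : ∀ {Δ A B} (p : Δ ⊢ A) → RightIntro (∨R₁ Δ A B p)
  ∨R₂ : ∀ {Δ A B} (p : Δ ⊢ B) → RightIntro (∨R₂ Δ A B p)
  ⇒R  : ∀ {Δ A B} (p : A ∷ Δ ⊢ B) → RightIntro (⇒R Δ A B p)

rightIntro : ∀ {Δ A} (p : Δ ⊢ A) → IntroR p → NotAxiom p → RightIntro p
rightIntro (ax _)           _  p≠ax = ⊥-elim (p≠ax tt)
rightIntro (botAx _)        _  p≠ax = ⊥-elim (p≠ax tt)
rightIntro (∧R _ _ _ p₁ p₂) _  _    = ∧R p₁ p₂
rightIntro (∨R₁ _ _ _ p)    _  _    = ∨R₁ p
rightIntro (∨R₂ _ _ _ p)    _  _    = ∨R₂ p
rightIntro (⇒R _ _ _ p)     _  _    = ⇒R p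
rightIntro (exch _ _ _ _ _)    ()
rightIntro (contr _ _ _ _)     ()
rightIntro (weak _ _ _ _)      ()
rightIntro (cut _ _ _ _ _ _)   ()
rightIntro (∧L₁ _ _ _ _ _)     ()
rightIntro (∧L₂ _ _ _ _ _)     ()
rightIntro (∨L _ _ _ _ _ _)    ()
rightIntro (⇒L _ _ _ _ _ _ _)  ()

data LeftIntro {C : Formula} : Ctx → Formula → Ctx → ∀ {Γ′} → Γ′ ⊢ C → Set where
  weak : ∀ {Θ A Γ} (q : Θ ++ Γ ⊢ C) → LeftIntro Θ A Γ (weak Θ Γ A q)
  ∧L₁  : ∀ {Θ A B Γ} (q : Θ ++ A ∷ Γ ⊢ C) → LeftIntro Θ (A ∧ B) Γ (∧L₁ Θ Γ A B q)
  ∧L₂  : ∀ {Θ A B Γ} (q : Θ ++ B ∷ Γ ⊢ C) → LeftIntro Θ (A ∧ B) Γ (∧L₂ Θ Γ A B q)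
  ∨L   : ∀ {Θ A B Γ} (q₁ : Θ ++ A ∷ Γ ⊢ C) (q₂ : Θ ++ B ∷ Γ ⊢ C) →
         LeftIntro Θ (A ∨ B) Γ (∨L Θ Γ A B q₁ q₂)
  ⇒L   : ∀ {Δ Θ A B Γ} (r : Δ ⊢ A) (q : Θ ++ B ∷ Γ ⊢ C) →
         LeftIntro (Θ ++ Δ) (A ⇒ B) Γ (⇒L Δ Θ Γ A B r q)

leftIntro : ∀ {Θ A Γ Γ′ C} (q : Γ′ ⊢ C) → Γ′ ≡ Θ ++ A ∷ Γ →
            IntroL q (length Θ) → NotAxiom q → LeftIntro Θ A Γ q
leftIntro {Θ} (weak Θ′ _ _ q) eq il _ with ++-injective Θ′ Θ (sym il) eq
... | refl , refl = weak q
leftIntro {Θ} (∧L₁ Θ′ _ _ _ q) eq il _ with ++-injective Θ′ Θ (sym il) eq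
... | refl , refl = ∧L₁ q
leftIntro {Θ} (∧L₂ Θ′ _ _ _ q) eq il _ with ++-injective Θ′ Θ (sym il) eq
... | refl , refl = ∧L₂ q
leftIntro {Θ} (∨L Θ′ _ _ _ q₁ q₂) eq il _ with ++-injective Θ′ Θ (sym il) eq
... | refl , refl = ∨L q₁ q₂
leftIntro {Θ} (⇒L Δ Θ′ _ _ _ r q) eq il _
  with ++-injective (Θ′ ++ Δ) Θ (trans (length-++ Θ′) (sym il))
                                 (trans (++-assoc Θ′ Δ _) eq)
... | refl , refl = ⇒L r q
leftIntro (ax _)    _ _ q≠ax = ⊥-elim (q≠ax tt)
leftIntro (botAx _) _ _ q≠ax = ⊥-elim (q≠ax tt)
leftIntro (exch _ _ _ _ _)  _ ()
leftIntro (contr _ _ _ _)   _ ()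
leftIntro (cut _ _ _ _ _ _) _ ()
leftIntro (∧R _ _ _ _ _)    _ ()
leftIntro (∨R₁ _ _ _ _)     _ ()
leftIntro (∨R₂ _ _ _ _)     _ ()
leftIntro (⇒R _ _ _ _)      _ ()

module _ {d : ℕ} (0<d : 0 < d) where
  mutual
    reduce : ∀ {Γ C} (p : Γ ⊢ C) → Maximalized p → degree p ≤ d → Γ ⊢[< d ] C
    reduce (ax A)    _ _ = ax A , 0<d
    reduce (botAx A) _ _ = botAx A , 0<d
    reduce (exch Δ Γ A B p) mp p≤d = map (exch Δ Γ A B) id (reduce p mp p≤d)
    reduce (contr Θ Γ A p)  mp p≤d = map (contr Θ Γ A) id (reduce p mp p≤d)
    reduce (weak Θ Γ A p)   mp p≤d = map (weak Θ Γ A) id (reduce p mp p≤d)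
    reduce (∧L₁ Θ Γ A B p)  mp p≤d = map (∧L₁ Θ Γ A B) id (reduce p mp p≤d)
    reduce (∧L₂ Θ Γ A B p)  mp p≤d = map (∧L₂ Θ Γ A B) id (reduce p mp p≤d)
    reduce (∨R₁ Γ A B p)    mp p≤d = map (∨R₁ Γ A B) id (reduce p mp p≤d)
    reduce (∨R₂ Γ A B p)    mp p≤d = map (∨R₂ Γ A B) id (reduce p mp p≤d)
    reduce (⇒R Γ A B p)     mp p≤d = map (⇒R Γ A B) id (reduce p mp p≤d)
    reduce (∧R Γ A B p q) mpq pq≤d =
      uncurry (zip (∧R Γ A B) ⊔-lub) (reduce₂ p q mpq pq≤d)
    reduce (∨L Θ Γ A B p q) mpq pq≤d =
      uncurry (zip (∨L Θ Γ A B) ⊔-lub) (reduce₂ p q mpq pq≤d)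
    reduce (⇒L Δ Θ Γ A B p q) mpq pq≤d =
      uncurry (zip (⇒L Δ Θ Γ A B) ⊔-lub) (reduce₂ p q mpq pq≤d)
    reduce (cut _ _ _ A p q) (((introR , introL) , p≠ax , q≠ax) , mp , mq) cut≤d =
      reduceCut (rightIntro p introR p≠ax) (leftIntro q refl introL q≠ax) mp mq
                (m⊔n≤o⇒m≤o _ _ cut≤d) (m⊔n≤o⇒m≤o _ _ pq≤d) (m⊔n≤o⇒n≤o _ _ pq≤d)
      where pq≤d = m⊔n≤o⇒n≤o (size A) _ cut≤d

    reduce₂ : ∀ {Γ C Γ′ C′} (p : Γ ⊢ C) (q : Γ′ ⊢ C′) → Maximalized p × Maximalized q →
              degree p ⊔ degree q ≤ d → (Γ ⊢[< d ] C) × (Γ′ ⊢[< d ] C′)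
    reduce₂ p q (mp , mq) pq≤d =
      reduce p mp (m⊔n≤o⇒m≤o _ _ pq≤d) , reduce q mq (m⊔n≤o⇒n≤o _ _ pq≤d)

    reduceCut : ∀ {Δ Θ A Γ Γ′ C} {p : Δ ⊢ A} {q : Γ′ ⊢ C} →
                RightIntro p → LeftIntro Θ A Γ q →
                Maximalized p → Maximalized q → size A ≤ d → degree p ≤ d → degree q ≤ d →
                Θ ++ Δ ++ Γ ⊢[< d ] C
    reduceCut {Δ} {Θ} _ (weak q) _ mq _ _ q≤d = weaken< Θ Δ (reduce q mq q≤d)
    reduceCut (∧R p₁ _) (∧L₁ q) (mp₁ , _) mq A≤d p≤d q≤d =
      cut< _ (1+m+n≤o⇒m<o A≤d) (reduce p₁ mp₁ (m⊔n≤o⇒m≤o _ _ p≤d)) (reduce q mq q≤d)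
    reduceCut (∧R _ p₂) (∧L₂ q) (_ , mp₂) mq A≤d p≤d q≤d =
      cut< _ (1+m+n≤o⇒n<o A≤d) (reduce p₂ mp₂ (m⊔n≤o⇒n≤o _ _ p≤d)) (reduce q mq q≤d)
    reduceCut (∨R₁ p₁) (∨L q₁ _) mp₁ (mq₁ , _) A≤d p≤d q≤d =
      cut< _ (1+m+n≤o⇒m<o A≤d) (reduce p₁ mp₁ p≤d) (reduce q₁ mq₁ (m⊔n≤o⇒m≤o _ _ q≤d))
    reduceCut (∨R₂ p₂) (∨L _ q₂) mp₂ (_ , mq₂) A≤d p≤d q≤d =
      cut< _ (1+m+n≤o⇒n<o A≤d) (reduce p₂ mp₂ p≤d) (reduce q₂ mq₂ (m⊔n≤o⇒n≤o _ _ q≤d))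
    reduceCut (⇒R p₁) (⇒L r q) mp₁ mrq A≤d p≤d rq≤d =
      uncurry (⇒-cut< A≤d (reduce p₁ mp₁ p≤d)) (reduce₂ r q mrq rq≤d)

theorem6p2 : ∀ {Γ : Ctx} {C : Formula} (p : Γ ⊢ C) →
    Maximalized p → 0 < degree p →
    Σ (Γ ⊢ C) (λ q → degree q < degree p)
theorem6p2 p mp 0<deg = reduce 0<deg p mp ≤-refl
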